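{- Let $G$ be a connected block graph that is not a complete graph. Then there exists a Roman $\{2\}$-dominating function $f$ of $G$ of weight $\gamma_{\{R2\}}(G)$ such that: (1) if $H$ is a block of type 1 and $v\in V(H)$ is not a cut-vertex, then $f(v)\in\{0,1\}$; (2) if $H$ is a block of type 2 and $v\in V(H)$ is not a cut-vertex, then $f(v)=0$.
   Context: For a graph $G=(V,E)$, a Roman $\{2\}$-dominating function is a function $f:V\to\{0,1,2\}$ such that every vertex $v$ with $f(v)=0$ satisfies $\sum_{u\in N(v)} f(u)\ge 2$; its weight is $\sum_{v\in V} f(v)$, and $\gamma_{\{R2\}}(G)$ is the minimum weight of such a function. A cut-vertex is a vertex whose removal increases the number of connected components. A block is a maximal connected induced subgraph without a cut-vertex; $G$ is a block graph if every block is complete. For a block $H$, let $I_H$ be the set of cut-vertices of $G$ lying in $H$; $H$ is of type 1 if $|V(H)|=|I_H|+1$ and of type 2 if $|V(H)|\ge |I_H|+2$. -}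

module Defs where

open import Data.Nat using (ℕ; zero; suc; _+_; _≤_)
open import Data.Bool using (Bool; true; false; if_then_else_)
open import Data.Fin using (Fin)
open import Data.Fin.Subset using (Subset; _∈_; _⊆_; ∣_∣)
open import Data.List using (map; allFin)
open import Data.Nat.ListAction using (sum)
open import Data.Product using (Σ; _×_; ∃; ∃-syntax)
open import Data.Sum using (_⊎_)
open import Data.Unit using (⊤)
open import Relation.Nullary using (¬_)
open import Relation.Binary.PropositionalEquality using (_≡_; _≢_)
open import Function.Bundles using (_⇔_)

record Graph (n : ℕ) : Set where
  field
    adj   : Fin n → Fin n → Bool
    sym   : ∀ x y → adj x y ≡ adj y x
    irrefl : ∀ x → adj x x ≡ false

module _ {n : ℕ} (G : Graph n) where
  open Graph G

  Adj : Fin n → Fin n → Set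
  Adj x y = adj x y ≡ true

  data ReachIn (S : Fin n → Set) : Fin n → Fin n → Set where
    here : ∀ {u} → S u → ReachIn S u u
    step : ∀ {u w v} → S u → Adj u w → ReachIn S w v → ReachIn S u v

  ConnectedIn : (Fin n → Set) → Set
  ConnectedIn S = ∀ u w → S u → S w → ReachIn S u w

  Connected : Set
  Connected = ConnectedIn (λ _ → ⊤)

  IsComplete : Set
  IsComplete = ∀ x y → x ≢ y → Adj x y

  CutVertexIn : (Fin n → Set) → Fin n → Set
  CutVertexIn S v = S v × ∃[ u ] ∃[ w ]
    (S u × S w × u ≢ v × w ≢ v × ReachIn S u w
      × ¬ ReachIn (λ z → S z × z ≢ v) u w)

  CutVertex : Fin n → Set
  CutVertex = CutVertexIn (λ _ → ⊤)

  Biconnected : Subset n → Set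
  Biconnected B = ConnectedIn (_∈ B) × (∀ v → ¬ CutVertexIn (_∈ B) v)

  IsBlock : Subset n → Set
  IsBlock B = Biconnected B × (∀ B' → B ⊆ B' → Biconnected B' → B' ⊆ B)

  IsBlockGraph : Set
  IsBlockGraph = ∀ B → IsBlock B → ∀ x y → x ∈ B → y ∈ B → x ≢ y → Adj x y

  CutSetOf : Subset n → Subset n → Set
  CutSetOf B I = ∀ x → (x ∈ I) ⇔ (x ∈ B × CutVertex x)

  Type1 : Subset n → Set
  Type1 B = Σ (Subset n) λ I → CutSetOf B I × ∣ B ∣ ≡ suc ∣ I ∣

  Type2 : Subset n → Set
  Type2 B = Σ (Subset n) λ I → CutSetOf B I × 2 + ∣ I ∣ ≤ ∣ B ∣

  nbrSum : (Fin n → ℕ) → Fin n → ℕ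
  nbrSum f v = sum (map (λ u → if adj v u then f u else 0) (allFin n))

  weight : (Fin n → ℕ) → ℕ
  weight f = sum (map f (allFin n))

  IsR2DF : (Fin n → ℕ) → Set
  IsR2DF f = (∀ v → f v ≤ 2) × (∀ v → f v ≡ 0 → 2 ≤ nbrSum f v)

  IsMinR2DF : (Fin n → ℕ) → Set
  IsMinR2DF f = IsR2DF f × (∀ g → IsR2DF g → weight f ≤ weight g)

-- Choose, among the minimum Roman {2}-dominating functions, one whose weight on simplicial
-- vertices is least. A vertex v that is not a cut-vertex of its block H has all its neighbours in
-- the clique H, so it is simplicial. As G is connected and not complete, H also contains a vertex c
-- with a neighbour outside H: c sees all of N[v] but is not simplicial. Whenever f v = 2, or
-- f v = 1 and f c ≥ 1, emptying v and putting 2 on c keeps f dominating without raising its weight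
-- while lowering the simplicial weight. In a block of type 2 there is a second non-cut vertex u,
-- all of whose neighbours see v; then f v = 1, f c = 0 is excluded by moving the unit from v to c:
-- v stays dominated by c and u if f u ≥ 1, and otherwise by c and the neighbours dominating u.
module Submission where

open import Defs
open import Data.Nat using (ℕ; zero; suc; _+_; _≤_; _<_; _≤?_; z≤n; s≤s)
open import Data.Nat.Properties
  using ( +-0-commutativeMonoid; ≤-refl; ≤-trans; ≤-reflexive; ≤-antisym; <-irrefl; <-≤-trans
        ; +-comm; +-assoc; +-suc; +-identityʳ; +-mono-≤; +-monoʳ-≤; +-mono-<-≤; m≤m+n; m≤n+m; n≤1+n; ≤⇒≯
        ; n≤1⇒n≡0∨n≡1; module ≤-Reasoning )
  renaming (_≟_ to _≟ℕ_)
import Data.Nat.ListAction as ListAction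
open import Algebra.Properties.CommutativeMonoid.Sum +-0-commutativeMonoid using (sum; sum-remove; sum-cong-≗)
open import Data.Bool using (Bool; true; false; if_then_else_)
import Data.Bool.Properties as Bool
open import Data.Fin using (Fin; zero; suc; punchIn; _≟_)
open import Data.Fin.Properties using (punchInᵢ≢i; any?; all?)
open import Data.Fin.Subset using (Subset; _∈_; _∉_; _⊆_; _∪_; ⁅_⁆; ∣_∣; inside; outside)
open import Data.Fin.Subset.Properties
  using (x∈⁅x⁆; x∈⁅y⁆⇒x≡y; x∈p∪q⁺; x∈p∪q⁻; p⊆p∪q; p⊆q⇒∣p∣≤∣q∣; ∣⁅x⁆∣≡1) renaming (_∈?_ to _∈ˢ?_)
open import Data.Vec using ([]; _∷_)
import Data.Vec.Functional as Vector
open import Data.Vec.Functional using (removeAt; updateAt)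
open import Data.Vec.Functional.Properties using (updateAt-updates; updateAt-minimal)
open import Data.List using (List; [_]; map; allFin; tabulate; filter; cartesianProductWith; upTo)
open import Data.List.Properties using (map-tabulate)
open import Data.List.Extrema.Nat using (argmin; argmin-all; f[argmin]≤f[xs])
import Data.List.Relation.Unary.All as All
open import Data.List.Relation.Unary.All.Properties using (all-filter)
open import Data.List.Relation.Unary.Any using (here)
open import Data.List.Membership.Propositional using () renaming (_∈_ to _∈ˡ_)
open import Data.List.Membership.Propositional.Properties using (∈-filter⁺; ∈-cartesianProductWith⁺; ∈-upTo⁺)
open import Data.Product using (Σ; _×_; _,_; proj₁; proj₂; ∃; ∃-syntax)
open import Data.Sum using (_⊎_; inj₁; inj₂)
import Data.Sum as Sum
open import Data.Empty using (⊥; ⊥-elim)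
open import Function using (_∘_; id; const)
open import Function.Bundles using (Equivalence)
open import Relation.Unary using (Decidable)
open import Relation.Nullary using (¬_; yes; no; Dec; does; contradiction)
open import Relation.Nullary.Decidable using (_×-dec_; _→-dec_; ¬?; dec-true; dec-false)
open import Relation.Binary.PropositionalEquality
  using (_≡_; _≢_; _≗_; refl; sym; trans; cong; cong₂; subst; subst₂; module ≡-Reasoning)

sum-mono : ∀ {n} {s t : Fin n → ℕ} → (∀ i → s i ≤ t i) → sum s ≤ sum t
sum-mono {zero}  s≤t = z≤n
sum-mono {suc _} s≤t = +-mono-≤ (s≤t zero) (sum-mono (s≤t ∘ suc))

sum-tabulate : ∀ {n} (t : Fin n → ℕ) → ListAction.sum (tabulate t) ≡ sum t
sum-tabulate {zero}  t = refl
sum-tabulate {suc n} t = cong (t zero +_) (sum-tabulate (t ∘ suc))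

sum-allFin : ∀ {n} (t : Fin n → ℕ) → ListAction.sum (map t (allFin n)) ≡ sum t
sum-allFin t = trans (cong ListAction.sum (map-tabulate id t)) (sum-tabulate t)

erase : ∀ {n} → (Fin n → ℕ) → Fin n → Fin n → ℕ
erase t i = updateAt t i (const 0)

erase-mono : ∀ {n} {s t : Fin n → ℕ} {i} k → (k ≢ i → s k ≤ t k) → erase s i k ≤ erase t i k
erase-mono {s = s} {t} {i} k s≤t with k ≟ i
... | yes refl = ≤-reflexive (trans (updateAt-updates k s) (sym (updateAt-updates k t)))
... | no k≢i   = subst₂ _≤_ (sym (updateAt-minimal k i s k≢i)) (sym (updateAt-minimal k i t k≢i)) (s≤t k≢i)

sum-erase : ∀ {n} (t : Fin n → ℕ) i → sum t ≡ t i + sum (erase t i)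
sum-erase {suc _} t i = trans (sum-remove t) (cong (t i +_) (sym sum-erased))
  where
  open ≡-Reasoning
  sum-erased : sum (erase t i) ≡ sum (removeAt t i)
  sum-erased = begin
    sum (erase t i)                             ≡⟨ sum-remove (erase t i) ⟩
    erase t i i + sum (removeAt (erase t i) i)  ≡⟨ cong (_+ sum (removeAt (erase t i) i)) (updateAt-updates i t) ⟩
    sum (removeAt (erase t i) i)                ≡⟨ sum-cong-≗ (λ k → updateAt-minimal (punchIn i k) i t (punchInᵢ≢i i k)) ⟩
    sum (removeAt t i)                          ∎

sum-erase₂ : ∀ {n} (t : Fin n → ℕ) {i j} → i ≢ j → sum t ≡ t i + t j + sum (erase (erase t i) j)
sum-erase₂ t {i} {j} i≢j = begin
  sum t                                            ≡⟨ sum-erase t i ⟩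
  t i + sum (erase t i)                            ≡⟨ cong (t i +_) (sum-erase (erase t i) j) ⟩
  t i + (erase t i j + sum (erase (erase t i) j))  ≡⟨ cong (λ x → t i + (x + sum (erase (erase t i) j))) erase-j ⟩
  t i + (t j + sum (erase (erase t i) j))          ≡⟨ +-assoc (t i) (t j) _ ⟨
  t i + t j + sum (erase (erase t i) j)            ∎
  where
  open ≡-Reasoning
  erase-j : erase t i j ≡ t j
  erase-j = updateAt-minimal j i t (i≢j ∘ sym)

≤-sum : ∀ {n} (t : Fin n → ℕ) i → t i ≤ sum t
≤-sum t i = ≤-trans (m≤m+n (t i) _) (≤-reflexive (sym (sum-erase t i)))

+≤-sum : ∀ {n} (t : Fin n → ℕ) {i j} → i ≢ j → t i + t j ≤ sum t
+≤-sum t i≢j = ≤-trans (m≤m+n _ _) (≤-reflexive (sym (sum-erase₂ t i≢j)))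

sum-mono-< : ∀ {n} {s t : Fin n → ℕ} {i} → (∀ k → s k ≤ t k) → s i < t i → sum s < sum t
sum-mono-< {s = s} {t} {i} s≤t sᵢ<tᵢ = begin-strict
  sum s                   ≡⟨ sum-erase s i ⟩
  s i + sum (erase s i)   <⟨ +-mono-<-≤ sᵢ<tᵢ (sum-mono (λ k → erase-mono k (λ _ → s≤t k))) ⟩
  t i + sum (erase t i)   ≡⟨ sum-erase t i ⟨
  sum t                   ∎
  where open ≤-Reasoning

sum-mono-except₂ : ∀ {n} {s t : Fin n → ℕ} {i j} → i ≢ j →
                   (∀ k → k ≢ i → k ≢ j → s k ≤ t k) → s i + s j ≤ t i + t j → sum s ≤ sum t
sum-mono-except₂ {s = s} {t} {i} {j} i≢j s≤t sᵢⱼ≤tᵢⱼ = begin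
  sum s                                   ≡⟨ sum-erase₂ s i≢j ⟩
  s i + s j + sum (erase (erase s i) j)   ≤⟨ +-mono-≤ sᵢⱼ≤tᵢⱼ (sum-mono erased) ⟩
  t i + t j + sum (erase (erase t i) j)   ≡⟨ sum-erase₂ t i≢j ⟨
  sum t                                   ∎
  where
  open ≤-Reasoning
  erased : ∀ k → erase (erase s i) j k ≤ erase (erase t i) j k
  erased k = erase-mono k (λ k≢j → erase-mono k (λ k≢i → s≤t k k≢i k≢j))

_when_ : ℕ → Bool → ℕ
a when b = if b then a else 0

when-≤ : ∀ a b → a when b ≤ a
when-≤ a true  = ≤-refl
when-≤ a false = z≤n

when-mono : ∀ b {a a′} → a ≤ a′ → a when b ≤ a′ when b
when-mono true  a≤a′ = a≤a′
when-mono false _    = z≤n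

0-when : ∀ b → 0 when b ≡ 0
0-when true  = refl
0-when false = refl

∣p∪q∣≤∣p∣+∣q∣ : ∀ {n} (p q : Subset n) → ∣ p ∪ q ∣ ≤ ∣ p ∣ + ∣ q ∣
∣p∪q∣≤∣p∣+∣q∣ []            []            = z≤n
∣p∪q∣≤∣p∣+∣q∣ (outside ∷ p) (outside ∷ q) = ∣p∪q∣≤∣p∣+∣q∣ p q
∣p∪q∣≤∣p∣+∣q∣ (outside ∷ p) (inside  ∷ q) = ≤-trans (s≤s (∣p∪q∣≤∣p∣+∣q∣ p q)) (≤-reflexive (sym (+-suc ∣ p ∣ ∣ q ∣)))
∣p∪q∣≤∣p∣+∣q∣ (inside  ∷ p) (outside ∷ q) = s≤s (∣p∪q∣≤∣p∣+∣q∣ p q)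
∣p∪q∣≤∣p∣+∣q∣ (inside  ∷ p) (inside  ∷ q) = s≤s (≤-trans (∣p∪q∣≤∣p∣+∣q∣ p q) (+-monoʳ-≤ ∣ p ∣ (n≤1+n ∣ q ∣)))

∈⁅⁆∪-split : ∀ {n} {x p : Fin n} {P} → x ∈ ⁅ p ⁆ ∪ P → x ≡ p ⊎ x ∈ P
∈⁅⁆∪-split {p = p} {P} x∈ with x∈p∪q⁻ ⁅ p ⁆ P x∈
... | inj₁ x∈⁅p⁆ = inj₁ (x∈⁅y⁆⇒x≡y p x∈⁅p⁆)
... | inj₂ x∈P   = inj₂ x∈P

∈⁅x⁆∪⁅y⁆ : ∀ {n} {z x y : Fin n} → z ∈ ⁅ x ⁆ ∪ ⁅ y ⁆ → z ≡ x ⊎ z ≡ y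
∈⁅x⁆∪⁅y⁆ {y = y} = Sum.map₂ (x∈⁅y⁆⇒x≡y y) ∘ ∈⁅⁆∪-split

module GraphTheory {n : ℕ} (G : Graph n) where
  open Graph G using (adj; irrefl)

  Adj-sym : ∀ {x y} → Adj G x y → Adj G y x
  Adj-sym {x} {y} xy = trans (Graph.sym G y x) xy

  Adj⇒≢ : ∀ {x y} → Adj G x y → x ≢ y
  Adj⇒≢ {x} xx refl with trans (sym xx) (irrefl x)
  ... | ()

  module _ {S : Fin n → Set} where
    reach-target : ∀ {u w} → ReachIn G S u w → S w
    reach-target (here s)     = s
    reach-target (step _ _ r) = reach-target r

    reach-trans : ∀ {u w x} → ReachIn G S u w → ReachIn G S w x → ReachIn G S u x
    reach-trans (here _)     r′ = r′
    reach-trans (step s a r) r′ = step s a (reach-trans r r′)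

    reach-edge : ∀ {u w} → S u → S w → Adj G u w → ReachIn G S u w
    reach-edge su sw uw = step su uw (here sw)

    reach-snoc : ∀ {u w x} → ReachIn G S u w → Adj G w x → S x → ReachIn G S u x
    reach-snoc r wx sx = reach-trans r (reach-edge (reach-target r) sx wx)

    reach-sym : ∀ {u w} → ReachIn G S u w → ReachIn G S w u
    reach-sym (here s)     = here s
    reach-sym (step s a r) = reach-snoc (reach-sym r) (Adj-sym a) s

  reach-mono : ∀ {S T : Fin n → Set} → (∀ {t} → S t → T t) → ∀ {u w} → ReachIn G S u w → ReachIn G T u w
  reach-mono S⊆T (here s)     = here (S⊆T s)
  reach-mono S⊆T (step s a r) = step (S⊆T s) a (reach-mono S⊆T r)

  reach-exit : ∀ {S : Fin n → Set} {H a z} → ReachIn G S a z → a ∈ H → z ∉ H →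
               ∃[ c ] ∃[ y ] c ∈ H × y ∉ H × Adj G c y
  reach-exit (here _) a∈H z∉H = contradiction a∈H z∉H
  reach-exit {a = a} (step {w = w} _ aw r) a∈H z∉H with w ∈ˢ? _
  ... | yes w∈H = reach-exit r w∈H z∉H
  ... | no  w∉H = a , w , a∈H , w∉H , aw

  data Path : Fin n → Fin n → Subset n → Set where
    trivial : ∀ {p} → Path p p ⁅ p ⁆
    extend  : ∀ {p w b P} → Adj G p w → p ∉ P → Path w b P → Path p b (⁅ p ⁆ ∪ P)

  ∈⁅x⁆∪ : ∀ x {P : Subset n} → x ∈ ⁅ x ⁆ ∪ P
  ∈⁅x⁆∪ x = x∈p∪q⁺ (inj₁ (x∈⁅x⁆ x))

  ∈-∪⁅⁆ : ∀ {x} p {P : Subset n} → x ∈ P → x ∈ ⁅ p ⁆ ∪ P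
  ∈-∪⁅⁆ p x∈P = x∈p∪q⁺ (inj₂ x∈P)

  path-source∈ : ∀ {p b P} → Path p b P → p ∈ P
  path-source∈ trivial           = x∈⁅x⁆ _
  path-source∈ (extend {p} _ _ _) = ∈⁅x⁆∪ p

  path-suffix : ∀ {p b P t} → Path p b P → t ∈ P → ∃[ Q ] Q ⊆ P × Path t b Q
  path-suffix {p} trivial t∈P rewrite x∈⁅y⁆⇒x≡y p t∈P = _ , (λ x∈ → x∈) , trivial
  path-suffix (extend {p} pw p∉P path) t∈P with ∈⁅⁆∪-split t∈P
  ... | inj₁ refl = _ , (λ x∈ → x∈) , extend pw p∉P path
  ... | inj₂ t∈P′ with path-suffix path t∈P′
  ...   | Q , Q⊆P , path′ = Q , ∈-∪⁅⁆ p ∘ Q⊆P , path′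

  reach⇒path : ∀ {S u w} → ReachIn G S u w → ∃[ P ] Path u w P × (∀ {t} → t ∈ P → S t)
  reach⇒path {u = u} (here su) = ⁅ u ⁆ , trivial , λ t∈ → subst _ (sym (x∈⁅y⁆⇒x≡y u t∈)) su
  reach⇒path {S} {u} (step su uw r) with reach⇒path r
  ... | P , path , P⊆S with u ∈ˢ? P
  ...   | yes u∈P = let Q , Q⊆P , path′ = path-suffix path u∈P in Q , path′ , P⊆S ∘ Q⊆P
  ...   | no  u∉P = ⁅ u ⁆ ∪ P , extend uw u∉P path , ⁅u⁆∪P⊆S
    where
    ⁅u⁆∪P⊆S : ∀ {t} → t ∈ ⁅ u ⁆ ∪ P → S t
    ⁅u⁆∪P⊆S t∈ with ∈⁅⁆∪-split t∈
    ... | inj₁ refl = su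
    ... | inj₂ t∈P  = P⊆S t∈P

  path-reach : ∀ {p b P t} → Path p b P → t ∈ P → ReachIn G (_∈ P) t b
  path-reach {p} trivial t∈P rewrite x∈⁅y⁆⇒x≡y p t∈P = here (x∈⁅x⁆ p)
  path-reach (extend {p} pw p∉P path) t∈P with ∈⁅⁆∪-split t∈P
  ... | inj₁ refl = step t∈P pw (reach-mono (∈-∪⁅⁆ p) (path-reach path (path-source∈ path)))
  ... | inj₂ t∈P′ = reach-mono (∈-∪⁅⁆ p) (path-reach path t∈P′)

  Avoiding : Subset n → Fin n → Fin n → Set
  Avoiding P z s = s ∈ P × s ≢ z

  avoiding-∪ : ∀ {P z s} p → Avoiding P z s → Avoiding (⁅ p ⁆ ∪ P) z s
  avoiding-∪ p (s∈P , s≢z) = ∈-∪⁅⁆ p s∈P , s≢z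

  path-reach-avoiding : ∀ {p b P t} z → Path p b P → t ∈ P → t ≢ z →
                        ReachIn G (Avoiding P z) t b ⊎ ReachIn G (Avoiding P z) t p
  path-reach-avoiding z trivial t∈P t≢z = inj₂ (subst (ReachIn G _ _) (x∈⁅y⁆⇒x≡y _ t∈P) (here (t∈P , t≢z)))
  path-reach-avoiding z (extend {p} pw p∉P path) t∈P t≢z with ∈⁅⁆∪-split t∈P
  ... | inj₁ refl = inj₂ (here (t∈P , t≢z))
  ... | inj₂ t∈P′ with path-reach-avoiding z path t∈P′ t≢z
  ...   | inj₁ t↝b = inj₁ (reach-mono (avoiding-∪ p) t↝b)
  ...   | inj₂ t↝w with p ≟ z
  ...     | yes refl = inj₁ (reach-mono (λ s∈ → ∈-∪⁅⁆ p s∈ , λ { refl → p∉P s∈ }) (path-reach path t∈P′))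
  ...     | no  p≢z  = inj₂ (reach-snoc (reach-mono (avoiding-∪ p) t↝w) (Adj-sym pw) (∈⁅x⁆∪ p , p≢z))

  Clique : Subset n → Set
  Clique B = ∀ x y → x ∈ B → y ∈ B → x ≢ y → Adj G x y

  clique-reach : ∀ {B} {T : Fin n → Set} → Clique B → ∀ {x y} → x ∈ B → y ∈ B → T x → T y → ReachIn G T x y
  clique-reach clique {x} {y} x∈B y∈B tx ty with x ≟ y
  ... | yes refl = here tx
  ... | no  x≢y  = reach-edge tx ty (clique x y x∈B y∈B x≢y)

  clique-biconnected : ∀ {B} → Clique B → Biconnected G B
  clique-biconnected clique =
      (λ u w u∈B w∈B → clique-reach clique u∈B w∈B u∈B w∈B)
    , λ z (_ , u , w , u∈B , w∈B , u≢z , w≢z , _ , ¬u↝w) →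
        ¬u↝w (clique-reach clique u∈B w∈B (u∈B , u≢z) (w∈B , w≢z))

  -- an ear: the path P leaves the clique at a (through its neighbour p) and re-enters it at b
  clique-ear-biconnected : ∀ {B a b p P} → Clique B → a ∈ B → b ∈ B → a ≢ b → Adj G a p →
                           Path p b P → a ∉ P → Biconnected G (B ∪ P)
  clique-ear-biconnected {B} {a} {b} {p} {P} clique a∈B b∈B a≢b ap path a∉P = connected , no-cut
    where
    inB : ∀ {x} → x ∈ B → x ∈ B ∪ P
    inB = x∈p∪q⁺ ∘ inj₁
    inP : ∀ {x} → x ∈ P → x ∈ B ∪ P
    inP = x∈p∪q⁺ ∘ inj₂
    ba : Adj G b a
    ba = clique b a b∈B a∈B (a≢b ∘ sym)

    to-a : ∀ {t} → t ∈ B ∪ P → ReachIn G (_∈ B ∪ P) t a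
    to-a t∈ with x∈p∪q⁻ B P t∈
    ... | inj₁ t∈B = clique-reach clique t∈B a∈B t∈ (inB a∈B)
    ... | inj₂ t∈P = reach-snoc (reach-mono inP (path-reach path t∈P)) ba (inB a∈B)

    connected : ConnectedIn G (_∈ B ∪ P)
    connected u w u∈ w∈ = reach-trans (to-a u∈) (reach-sym (to-a w∈))

    without-a-to-b : ∀ {t} → t ∈ B ∪ P → t ≢ a → ReachIn G (Avoiding (B ∪ P) a) t b
    without-a-to-b t∈ t≢a with x∈p∪q⁻ B P t∈
    ... | inj₁ t∈B = clique-reach clique t∈B b∈B (t∈ , t≢a) (inB b∈B , a≢b ∘ sym)
    ... | inj₂ t∈P = reach-mono (λ s∈P → inP s∈P , λ { refl → a∉P s∈P }) (path-reach path t∈P)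

    widen : ∀ {z s} → Avoiding P z s → Avoiding (B ∪ P) z s
    widen (s∈P , s≢z) = inP s∈P , s≢z

    without-z-to-a : ∀ {z t} → a ≢ z → t ∈ B ∪ P → t ≢ z → ReachIn G (Avoiding (B ∪ P) z) t a
    without-z-to-a a≢z t∈ t≢z with x∈p∪q⁻ B P t∈
    ... | inj₁ t∈B = clique-reach clique t∈B a∈B (t∈ , t≢z) (inB a∈B , a≢z)
    ... | inj₂ t∈P with path-reach-avoiding _ path t∈P t≢z
    ...   | inj₁ t↝b = reach-snoc (reach-mono widen t↝b) ba (inB a∈B , a≢z)
    ...   | inj₂ t↝p = reach-snoc (reach-mono widen t↝p) (Adj-sym ap) (inB a∈B , a≢z)

    no-cut : ∀ z → ¬ CutVertexIn G (_∈ B ∪ P) z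
    no-cut z (_ , u , w , u∈ , w∈ , u≢z , w≢z , _ , ¬u↝w) with a ≟ z
    ... | yes refl = ¬u↝w (reach-trans (without-a-to-b u∈ u≢z) (reach-sym (without-a-to-b w∈ w≢z)))
    ... | no  a≢z  = ¬u↝w (reach-trans (without-z-to-a a≢z u∈ u≢z) (reach-sym (without-z-to-a a≢z w∈ w≢z)))

  edge-clique : ∀ {v y} → Adj G v y → Clique (⁅ v ⁆ ∪ ⁅ y ⁆)
  edge-clique vy x x′ x∈ x′∈ x≢x′ with ∈⁅x⁆∪⁅y⁆ x∈ | ∈⁅x⁆∪⁅y⁆ x′∈
  ... | inj₁ refl | inj₂ refl = vy
  ... | inj₂ refl | inj₁ refl = Adj-sym vy
  ... | inj₁ refl | inj₁ refl = contradiction refl x≢x′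
  ... | inj₂ refl | inj₂ refl = contradiction refl x≢x′

  Simplicial : Fin n → Set
  Simplicial x = ∀ a b → Adj G x a → Adj G x b → a ≢ b → Adj G a b

  Simplicial? : ∀ x → Dec (Simplicial x)
  Simplicial? x = all? λ a → all? λ b →
    (adj x a Bool.≟ true) →-dec ((adj x b Bool.≟ true) →-dec (¬? (a ≟ b) →-dec (adj a b Bool.≟ true)))

  -- together with v ~ c this says N[v] ⊆ N[c]
  Dominates : Fin n → Fin n → Set
  Dominates c v = ∀ w → Adj G v w → w ≢ c → Adj G c w

module BlockStructure {n : ℕ} (G : Graph n) (connected : Connected G) (blockGraph : IsBlockGraph G) where
  open GraphTheory G

  module _ {H : Subset n} (block : IsBlock G H) where
    private
      clique : Clique H
      clique = blockGraph H block

      maximal : ∀ {B y} → H ⊆ B → Biconnected G B → y ∈ B → y ∈ H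
      maximal H⊆B B-biconnected y∈B = proj₂ block _ H⊆B B-biconnected y∈B

    nonCut-neighbour∈ : ∀ {v y} → v ∈ H → ¬ CutVertex G v → Adj G v y → y ∈ H
    nonCut-neighbour∈ {v} {y} v∈H v-nonCut vy with y ∈ˢ? H
    ... | yes y∈H = y∈H
    ... | no  y∉H with any? (λ x → (x ∈ˢ? H) ×-dec ¬? (x ≟ v))
    ...   | no  no-other-in-H =
      contradiction (maximal H⊆⁅v⁆∪⁅y⁆ (clique-biconnected (edge-clique vy)) (x∈p∪q⁺ (inj₂ (x∈⁅x⁆ y)))) y∉H
      where
      H⊆⁅v⁆∪⁅y⁆ : H ⊆ ⁅ v ⁆ ∪ ⁅ y ⁆
      H⊆⁅v⁆∪⁅y⁆ {x} x∈H with x ≟ v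
      ... | yes refl = x∈p∪q⁺ (inj₁ (x∈⁅x⁆ x))
      ... | no  x≢v  = contradiction (x , x∈H , x≢v) no-other-in-H
    ...   | yes (x , x∈H , x≢v) =
      contradiction (_ , x , y , _ , _ , x≢v , Adj⇒≢ vy ∘ sym , connected x y _ _ , ¬x↝y) v-nonCut
      where
      -- a path from y back to x avoiding v would be an ear enlarging the block
      ¬x↝y : ¬ ReachIn G (λ z → _ × z ≢ v) x y
      ¬x↝y x↝y with reach⇒path (reach-sym x↝y)
      ... | P , path , P-avoids-v = y∉H (maximal (p⊆p∪q P)
              (clique-ear-biconnected clique v∈H x∈H (x≢v ∘ sym) vy path (λ v∈P → proj₂ (P-avoids-v v∈P) refl))
              (x∈p∪q⁺ (inj₂ (path-source∈ path))))

    nonCut-simplicial : ∀ {v} → v ∈ H → ¬ CutVertex G v → Simplicial v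
    nonCut-simplicial v∈H v-nonCut a b va vb a≢b =
      clique a b (nonCut-neighbour∈ v∈H v-nonCut va) (nonCut-neighbour∈ v∈H v-nonCut vb) a≢b

    nonCut-dominated : ∀ {u c} → u ∈ H → ¬ CutVertex G u → c ∈ H → Dominates c u
    nonCut-dominated u∈H u-nonCut c∈H w uw w≢c = clique _ w c∈H (nonCut-neighbour∈ u∈H u-nonCut uw) (w≢c ∘ sym)

    attachment : ¬ IsComplete G → ∀ {v} → v ∈ H → ¬ CutVertex G v → ∃[ c ] c ∈ H × Adj G v c × ¬ Simplicial c
    attachment incomplete {v} v∈H v-nonCut with any? (λ z → ¬? (z ∈ˢ? H))
    ... | no  nothing-outside-H = contradiction (λ x y → clique x y (everything∈H x) (everything∈H y)) incomplete
      where
      everything∈H : ∀ x → x ∈ H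
      everything∈H x with x ∈ˢ? H
      ... | yes x∈H = x∈H
      ... | no  x∉H = contradiction (x , x∉H) nothing-outside-H
    ... | yes (z , z∉H) with reach-exit (connected v z _ _) v∈H z∉H
    ...   | c , y , c∈H , y∉H , cy = c , c∈H , clique v c v∈H c∈H v≢c , c-not-simplicial
      where
      v≢c : v ≢ c
      v≢c refl = y∉H (nonCut-neighbour∈ v∈H v-nonCut cy)
      c-not-simplicial : ¬ Simplicial c
      c-not-simplicial c-simplicial = y∉H (nonCut-neighbour∈ v∈H v-nonCut
        (c-simplicial v y (clique c v c∈H v∈H (v≢c ∘ sym)) cy λ { refl → y∉H v∈H }))

    type2-another-nonCut : Type2 G H → ∀ {v} → v ∈ H → ∃[ u ] u ∈ H × u ≢ v × ¬ CutVertex G u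
    type2-another-nonCut (I , I-cut , ∣H∣≥2+∣I∣) {v} v∈H
      with any? (λ u → (u ∈ˢ? H) ×-dec (¬? (u ≟ v) ×-dec ¬? (u ∈ˢ? I)))
    ... | yes (u , u∈H , u≢v , u∉I) = u , u∈H , u≢v , λ u-cut → u∉I (Equivalence.from (I-cut u) (u∈H , u-cut))
    ... | no  all-others-cut = contradiction ∣H∣≥2+∣I∣ (≤⇒≯ ∣H∣≤1+∣I∣)
      where
      H⊆I∪⁅v⁆ : H ⊆ I ∪ ⁅ v ⁆
      H⊆I∪⁅v⁆ {x} x∈H with x ≟ v | x ∈ˢ? I
      ... | yes refl | _       = x∈p∪q⁺ (inj₂ (x∈⁅x⁆ x))
      ... | no  _    | yes x∈I = x∈p∪q⁺ (inj₁ x∈I)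
      ... | no  x≢v  | no  x∉I = contradiction (x , x∈H , x≢v , x∉I) all-others-cut
      ∣H∣≤1+∣I∣ : ∣ H ∣ ≤ suc ∣ I ∣
      ∣H∣≤1+∣I∣ = begin
        ∣ H ∣              ≤⟨ p⊆q⇒∣p∣≤∣q∣ H⊆I∪⁅v⁆ ⟩
        ∣ I ∪ ⁅ v ⁆ ∣      ≤⟨ ∣p∪q∣≤∣p∣+∣q∣ I ⁅ v ⁆ ⟩
        ∣ I ∣ + ∣ ⁅ v ⁆ ∣  ≡⟨ cong (∣ I ∣ +_) (∣⁅x⁆∣≡1 v) ⟩
        ∣ I ∣ + 1          ≡⟨ +-comm ∣ I ∣ 1 ⟩
        suc ∣ I ∣          ∎
        where open ≤-Reasoning

module Domination {n : ℕ} (G : Graph n) where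
  open Graph G using (adj)
  open GraphTheory G

  weight≡sum : ∀ f → weight G f ≡ sum f
  weight≡sum = sum-allFin

  nbrSum≡sum : ∀ f w → nbrSum G f w ≡ sum (λ u → f u when adj w u)
  nbrSum≡sum f w = sum-allFin (λ u → f u when adj w u)

  ≤-nbrSum : ∀ f {w u} → Adj G w u → f u ≤ nbrSum G f w
  ≤-nbrSum f {w} {u} wu = subst₂ _≤_ (cong (f u when_) wu) (sym (nbrSum≡sum f w)) (≤-sum _ u)

  +≤-nbrSum : ∀ f {w u u′} → Adj G w u → Adj G w u′ → u ≢ u′ → f u + f u′ ≤ nbrSum G f w
  +≤-nbrSum f {w} {u} {u′} wu wu′ u≢u′ =
    subst₂ _≤_ (cong₂ _+_ (cong (f u when_) wu) (cong (f u′ when_) wu′)) (sym (nbrSum≡sum f w)) (+≤-sum _ u≢u′)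

  simplicialWeight : (Fin n → ℕ) → ℕ
  simplicialWeight f = sum (λ x → f x when does (Simplicial? x))

  shift : (Fin n → ℕ) → Fin n → Fin n → ℕ → Fin n → ℕ
  shift f v c k = updateAt (erase f v) c (const k)

  data Position (v c x : Fin n) : Set where
    at-c      : x ≡ c → Position v c x
    at-v      : x ≡ v → Position v c x
    elsewhere : x ≢ c → x ≢ v → Position v c x

  position : ∀ v c x → Position v c x
  position v c x with x ≟ c | x ≟ v
  ... | yes x≡c | _       = at-c x≡c
  ... | no  _   | yes x≡v = at-v x≡v
  ... | no  x≢c | no  x≢v = elsewhere x≢c x≢v

  module Shift (f : Fin n → ℕ) {v c : Fin n} (vc : Adj G v c) (k : ℕ) where
    g : Fin n → ℕ
    g = shift f v c k

    c≢v : c ≢ v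
    c≢v = Adj⇒≢ vc ∘ sym

    g-at-c : g c ≡ k
    g-at-c = updateAt-updates c (erase f v)

    g-at-v : g v ≡ 0
    g-at-v = trans (updateAt-minimal v c (erase f v) (c≢v ∘ sym)) (updateAt-updates v f)

    g-elsewhere : ∀ {x} → x ≢ c → x ≢ v → g x ≡ f x
    g-elsewhere {x} x≢c x≢v = trans (updateAt-minimal x c (erase f v) x≢c) (updateAt-minimal x v f x≢v)

    weight-≤ : k ≤ f c + f v → weight G g ≤ weight G f
    weight-≤ k≤ = subst₂ _≤_ (sym (weight≡sum g)) (sym (weight≡sum f))
      (sum-mono-except₂ c≢v (λ x x≢c x≢v → ≤-reflexive (g-elsewhere x≢c x≢v))
        (subst (_≤ f c + f v) (sym (trans (cong₂ _+_ g-at-c g-at-v) (+-identityʳ k))) k≤))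

    ≤-nbrSum-via-c : ∀ {w} → Adj G w c → k ≤ nbrSum G g w
    ≤-nbrSum-via-c {w} wc = subst (_≤ nbrSum G g w) g-at-c (≤-nbrSum g wc)

    bounded : k ≤ 2 → (∀ x → f x ≤ 2) → ∀ x → g x ≤ 2
    bounded k≤2 f≤2 x with position v c x
    ... | at-c refl           = subst (_≤ 2) (sym g-at-c) k≤2
    ... | at-v refl           = subst (_≤ 2) (sym g-at-v) z≤n
    ... | elsewhere x≢c x≢v   = subst (_≤ 2) (sym (g-elsewhere x≢c x≢v)) (f≤2 x)

    nbrSum-away : f c ≤ k → ∀ {w} → adj w v ≡ false → nbrSum G f w ≤ nbrSum G g w
    nbrSum-away fc≤k {w} wv = subst₂ _≤_ (sym (nbrSum≡sum f w)) (sym (nbrSum≡sum g w)) (sum-mono termwise)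
      where
      termwise : ∀ x → f x when adj w x ≤ g x when adj w x
      termwise x with position v c x
      ... | at-c refl         = when-mono (adj w c) (subst (f c ≤_) (sym g-at-c) fc≤k)
      ... | at-v refl         = subst (_≤ g v when adj w v) (sym (cong (f v when_) wv)) z≤n
      ... | elsewhere x≢c x≢v = ≤-reflexive (cong (_when adj w x) (sym (g-elsewhere x≢c x≢v)))

    -- the unit taken from v reappears on c, which w′ sees
    nbrSum-transfer : k ≡ 1 → f c ≡ 0 → f v ≡ 1 → ∀ {w w′} → Adj G w′ c →
                      (∀ x → x ≢ c → x ≢ v → Adj G w x → Adj G w′ x) → nbrSum G f w ≤ nbrSum G g w′
    nbrSum-transfer refl fc≡0 fv≡1 {w} {w′} w′c sees =
      subst₂ _≤_ (sym (nbrSum≡sum f w)) (sym (nbrSum≡sum g w′)) (sum-mono-except₂ c≢v termwise at-c-and-v)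
      where
      termwise : ∀ x → x ≢ c → x ≢ v → f x when adj w x ≤ g x when adj w′ x
      termwise x x≢c x≢v with adj w x in wx
      ... | false = z≤n
      ... | true  = ≤-reflexive (sym (trans (cong (g x when_) (sees x x≢c x≢v wx)) (g-elsewhere x≢c x≢v)))
      at-c-and-v : f c when adj w c + f v when adj w v ≤ g c when adj w′ c + g v when adj w′ v
      at-c-and-v = ≤-trans (+-mono-≤ (when-≤ (f c) (adj w c)) (when-≤ (f v) (adj w v)))
        (subst₂ _≤_ (sym (cong₂ _+_ fc≡0 fv≡1))
                    (cong (_+ g v when adj w′ v) (sym (trans (cong (g c when_) w′c) g-at-c)))
                    (s≤s z≤n))

    simplicialWeight-< : Simplicial v → ¬ Simplicial c → 0 < f v → simplicialWeight g < simplicialWeight f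
    simplicialWeight-< v-simplicial c-not-simplicial 0<fv = sum-mono-< termwise at-v-<
      where
      termwise : ∀ x → g x when does (Simplicial? x) ≤ f x when does (Simplicial? x)
      termwise x with position v c x
      ... | at-c refl         = subst (_≤ _) (sym (cong (g c when_) (dec-false (Simplicial? c) c-not-simplicial))) z≤n
      ... | at-v refl         = subst (_≤ _) (sym (trans (cong (_when _) g-at-v) (0-when _))) z≤n
      ... | elsewhere x≢c x≢v = ≤-reflexive (cong (_when _) (g-elsewhere x≢c x≢v))
      at-v-< : g v when does (Simplicial? v) < f v when does (Simplicial? v)
      at-v-< = subst₂ _<_ (sym (trans (cong (_when _) g-at-v) (0-when _)))
                          (sym (cong (f v when_) (dec-true (Simplicial? v) v-simplicial))) 0<fv

  shift-R2DF-2 : ∀ {f v c} → IsR2DF G f → Adj G v c → Dominates c v → IsR2DF G (shift f v c 2)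
  shift-R2DF-2 {f} {v} {c} (f≤2 , f-dominating) vc c-dom = bounded ≤-refl f≤2 , g-dominating
    where
    open Shift f vc 2
    g-dominating : ∀ w → g w ≡ 0 → 2 ≤ nbrSum G g w
    g-dominating w gw≡0 with position v c w
    ... | at-c refl = contradiction (trans (sym g-at-c) gw≡0) λ ()
    ... | at-v refl = ≤-nbrSum-via-c vc
    ... | elsewhere w≢c w≢v with adj w v in wv
    ...   | true  = ≤-nbrSum-via-c (Adj-sym (c-dom w (Adj-sym wv) w≢c))
    ...   | false = ≤-trans (f-dominating w (trans (sym (g-elsewhere w≢c w≢v)) gw≡0)) (nbrSum-away (f≤2 c) wv)

  -- u is a second neighbour of v whose own neighbours all see v: it keeps v dominated once v is emptied
  shift-R2DF-1 : ∀ {f v c u} → IsR2DF G f → Adj G v c → Dominates c v → f c ≡ 0 → f v ≡ 1 →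
                 Adj G v u → u ≢ c → Dominates v u → IsR2DF G (shift f v c 1)
  shift-R2DF-1 {f} {v} {c} {u} (f≤2 , f-dominating) vc c-dom fc≡0 fv≡1 vu u≢c v-dom-u =
    bounded (s≤s z≤n) f≤2 , g-dominating
    where
    open Shift f vc 1
    g-dominating : ∀ w → g w ≡ 0 → 2 ≤ nbrSum G g w
    g-dominating w gw≡0 with position v c w
    ... | at-c refl = contradiction (trans (sym g-at-c) gw≡0) λ ()
    ... | at-v refl with f u in fu
    ...   | zero  = ≤-trans (f-dominating u fu)
                      (nbrSum-transfer refl fc≡0 fv≡1 vc (λ x _ x≢v ux → v-dom-u x ux x≢v))
    ...   | suc _ = ≤-trans (s≤s (s≤s z≤n))
                      (subst (_≤ nbrSum G g v) (cong₂ _+_ g-at-c (trans (g-elsewhere u≢c (Adj⇒≢ vu ∘ sym)) fu))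
                        (+≤-nbrSum g vc vu (u≢c ∘ sym)))
    g-dominating w gw≡0 | elsewhere w≢c w≢v with adj w v in wv
    ...   | true  = ≤-trans (f-dominating w (trans (sym (g-elsewhere w≢c w≢v)) gw≡0))
                      (nbrSum-transfer refl fc≡0 fv≡1 (Adj-sym (c-dom w (Adj-sym wv) w≢c)) (λ _ _ _ wx → wx))
    ...   | false = ≤-trans (f-dominating w (trans (sym (g-elsewhere w≢c w≢v)) gw≡0))
                      (nbrSum-away (subst (_≤ 1) (sym fc≡0) z≤n) wv)

functionsInto : ∀ {A : Set} → List A → ∀ n → List (Fin n → A)
functionsInto as zero    = [ Vector.[] ]
functionsInto as (suc n) = cartesianProductWith Vector._∷_ as (functionsInto as n)

functionsInto-complete : ∀ {A : Set} (as : List A) {n} (t : Fin n → A) →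
                         (∀ i → t i ∈ˡ as) → ∃[ h ] h ∈ˡ functionsInto as n × h ≗ t
functionsInto-complete as {zero}  t t∈as = Vector.[] , here refl , λ ()
functionsInto-complete as {suc n} t t∈as with functionsInto-complete as (t ∘ suc) (t∈as ∘ suc)
... | h , h∈ , h≗t =
  t zero Vector.∷ h , ∈-cartesianProductWith⁺ Vector._∷_ (t∈as zero) h∈ , λ { zero → refl ; (suc i) → h≗t i }

minimiser : ∀ {A : Set} {P : A → Set} → Decidable P → (key : A → ℕ) (xs : List A) → ∀ {a₀} → P a₀ →
            ∃[ a ] P a × (∀ {b} → b ∈ˡ xs → P b → key a ≤ key b)
minimiser P? key xs {a₀} Pa₀ =
    argmin key a₀ (filter P? xs)
  , argmin-all key Pa₀ (all-filter P? xs)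
  , λ b∈xs Pb → All.lookup (f[argmin]≤f[xs] a₀ (filter P? xs)) (∈-filter⁺ P? b∈xs Pb)

module Optimal {n : ℕ} (G : Graph n) where
  open Graph G using (adj)
  open GraphTheory G
  open Domination G

  record LexMinimal (f : Fin n → ℕ) : Set where
    field
      minimum          : IsMinR2DF G f
      simplicial-least : ∀ g → IsMinR2DF G g → simplicialWeight f ≤ simplicialWeight g

  no-improvement : ∀ {f g} → LexMinimal f → IsR2DF G g → weight G g ≤ weight G f →
                   simplicialWeight g < simplicialWeight f → ⊥
  no-improvement {f} {g} f-lexMin g-R2DF wg≤wf sg<sf = <-irrefl refl (<-≤-trans sg<sf (simplicial-least g g-minimum))
    where
    open LexMinimal f-lexMin
    g-minimum : IsMinR2DF G g
    g-minimum = g-R2DF , λ h h-R2DF → ≤-trans wg≤wf (proj₂ minimum h h-R2DF)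

  module _ {f g : Fin n → ℕ} (f≗g : f ≗ g) where
    weight-cong : weight G f ≡ weight G g
    weight-cong = trans (weight≡sum f) (trans (sum-cong-≗ f≗g) (sym (weight≡sum g)))

    nbrSum-cong : ∀ w → nbrSum G f w ≡ nbrSum G g w
    nbrSum-cong w = trans (nbrSum≡sum f w)
      (trans (sum-cong-≗ (λ u → cong (_when adj w u) (f≗g u))) (sym (nbrSum≡sum g w)))

    simplicialWeight-cong : simplicialWeight f ≡ simplicialWeight g
    simplicialWeight-cong = sum-cong-≗ (λ x → cong (_when _) (f≗g x))

    IsR2DF-cong : IsR2DF G g → IsR2DF G f
    IsR2DF-cong (g≤2 , g-dominating) =
        (λ v → subst (_≤ 2) (sym (f≗g v)) (g≤2 v))
      , (λ v fv≡0 → subst (2 ≤_) (sym (nbrSum-cong v)) (g-dominating v (trans (sym (f≗g v)) fv≡0)))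

  IsR2DF? : Decidable (IsR2DF G)
  IsR2DF? f = all? (λ v → f v ≤? 2) ×-dec all? (λ v → (f v ≟ℕ 0) →-dec (2 ≤? nbrSum G f v))

  candidates : List (Fin n → ℕ)
  candidates = functionsInto (upTo 3) n

  candidate : ∀ {g} → IsR2DF G g → ∃[ h ] h ∈ˡ candidates × IsR2DF G h × h ≗ g
  candidate {g} g-R2DF with functionsInto-complete (upTo 3) g (λ i → ∈-upTo⁺ (s≤s (proj₁ g-R2DF i)))
  ... | h , h∈ , h≗g = h , h∈ , IsR2DF-cong h≗g g-R2DF , h≗g

  lexMinimal : ∃ LexMinimal
  lexMinimal with minimiser IsR2DF? (weight G) candidates {const 1} ((λ _ → s≤s z≤n) , λ _ ())
  ... | f₁ , f₁-R2DF , f₁-least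
    with minimiser (λ h → IsR2DF? h ×-dec (weight G h ≟ℕ weight G f₁)) simplicialWeight candidates (f₁-R2DF , refl)
  ...   | f , (f-R2DF , wf≡wf₁) , f-least =
    f , record { minimum = f-R2DF , f-min ; simplicial-least = f-simplicial-least }
    where
    f-min : ∀ g → IsR2DF G g → weight G f ≤ weight G g
    f-min g g-R2DF with candidate g-R2DF
    ... | h , h∈ , h-R2DF , h≗g = subst₂ _≤_ (sym wf≡wf₁) (weight-cong h≗g) (f₁-least h∈ h-R2DF)

    f-simplicial-least : ∀ g → IsMinR2DF G g → simplicialWeight f ≤ simplicialWeight g
    f-simplicial-least g (g-R2DF , g-min) with candidate g-R2DF
    ... | h , h∈ , h-R2DF , h≗g =
      subst (simplicialWeight f ≤_) (simplicialWeight-cong h≗g) (f-least h∈ (h-R2DF , wh≡wf₁))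
      where
      wh≡wf₁ : weight G h ≡ weight G f₁
      wh≡wf₁ = trans (weight-cong h≗g)
        (≤-antisym (subst (weight G g ≤_) wf≡wf₁ (g-min f f-R2DF)) (subst (_≤ weight G g) wf≡wf₁ (f-min g g-R2DF)))

  module _ {f v c} (f-lexMin : LexMinimal f) (v-simplicial : Simplicial v) (c-not-simplicial : ¬ Simplicial c)
           (vc : Adj G v c) (c-dom : Dominates c v) where
    open LexMinimal f-lexMin

    lexMinimal-¬heavy : 1 ≤ f v → 2 ≤ f c + f v → ⊥
    lexMinimal-¬heavy 1≤fv 2≤fc+fv = no-improvement f-lexMin (shift-R2DF-2 (proj₁ minimum) vc c-dom)
      (Shift.weight-≤ f vc 2 2≤fc+fv) (Shift.simplicialWeight-< f vc 2 v-simplicial c-not-simplicial 1≤fv)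

    lexMinimal-¬lone-unit : f v ≡ 1 → f c ≡ 0 → ∀ {u} → Adj G v u → u ≢ c → Dominates v u → ⊥
    lexMinimal-¬lone-unit fv≡1 fc≡0 vu u≢c v-dom-u = no-improvement f-lexMin
      (shift-R2DF-1 (proj₁ minimum) vc c-dom fc≡0 fv≡1 vu u≢c v-dom-u)
      (Shift.weight-≤ f vc 1 (subst (1 ≤_) (sym (cong₂ _+_ fc≡0 fv≡1)) ≤-refl))
      (Shift.simplicialWeight-< f vc 1 v-simplicial c-not-simplicial (subst (1 ≤_) (sym fv≡1) ≤-refl))

module _ {n : ℕ} {G : Graph n} (connected : Connected G) (blockGraph : IsBlockGraph G) (incomplete : ¬ IsComplete G)
         {f : Fin n → ℕ} (f-lexMin : Optimal.LexMinimal G f)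
         {H : Subset n} (block : IsBlock G H) {v : Fin n} (v∈H : v ∈ H) (v-nonCut : ¬ CutVertex G v) where
  open BlockStructure G connected blockGraph
  open Optimal G using (lexMinimal-¬heavy; lexMinimal-¬lone-unit)
  open GraphTheory G using (Simplicial)

  private
    v-simplicial : Simplicial v
    v-simplicial = nonCut-simplicial block v∈H v-nonCut

    lexMinimal-¬heavy-at : ∀ {c} → c ∈ H → Adj G v c → ¬ Simplicial c → 1 ≤ f v → 2 ≤ f c + f v → ⊥
    lexMinimal-¬heavy-at c∈H vc c-not-simplicial =
      lexMinimal-¬heavy f-lexMin v-simplicial c-not-simplicial vc (nonCut-dominated block v∈H v-nonCut c∈H)

  nonCut-value≤1 : f v ≤ 1
  nonCut-value≤1 with attachment block incomplete v∈H v-nonCut | f v in fv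
  ... | _ | zero     = z≤n
  ... | _ | suc zero = s≤s z≤n
  ... | c , c∈H , vc , c-not-simplicial | suc (suc _) = ⊥-elim (lexMinimal-¬heavy-at c∈H vc c-not-simplicial
      (subst (1 ≤_) (sym fv) (s≤s z≤n)) (≤-trans (subst (2 ≤_) (sym fv) (s≤s (s≤s z≤n))) (m≤n+m (f v) (f c))))

  nonCut-in-type2-value≡0 : Type2 G H → f v ≡ 0
  nonCut-in-type2-value≡0 type2 with n≤1⇒n≡0∨n≡1 nonCut-value≤1
  ... | inj₁ fv≡0 = fv≡0
  ... | inj₂ fv≡1 with attachment block incomplete v∈H v-nonCut | type2-another-nonCut block type2 v∈H
  ...   | c , c∈H , vc , c-not-simplicial | u , u∈H , u≢v , u-nonCut with f c in fc
  ...     | zero  = ⊥-elim (lexMinimal-¬lone-unit f-lexMin v-simplicial c-not-simplicial vc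
                      (nonCut-dominated block v∈H v-nonCut c∈H) fv≡1 fc
                      (blockGraph H block v u v∈H u∈H (u≢v ∘ sym))
                      (λ { refl → c-not-simplicial (nonCut-simplicial block u∈H u-nonCut) })
                      (nonCut-dominated block u∈H u-nonCut v∈H))
  ...     | suc m = ⊥-elim (lexMinimal-¬heavy-at c∈H vc c-not-simplicial
                      (subst (1 ≤_) (sym fv≡1) ≤-refl) (subst (2 ≤_) (sym (cong₂ _+_ fc fv≡1)) (s≤s (m≤n+m 1 m))))

lemma8 : {n : ℕ} (G : Graph n) → Connected G → IsBlockGraph G → ¬ IsComplete G →
    Σ (Fin n → ℕ) λ f → IsMinR2DF G f
      × (∀ (H : Subset n) → IsBlock G H → Type1 G H →
           ∀ v → v ∈ H → ¬ CutVertex G v → (f v ≡ 0 ⊎ f v ≡ 1))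
      × (∀ (H : Subset n) → IsBlock G H → Type2 G H →
           ∀ v → v ∈ H → ¬ CutVertex G v → f v ≡ 0)
lemma8 G connected blockGraph incomplete with Optimal.lexMinimal G
... | f , f-lexMin =
    f , Optimal.LexMinimal.minimum f-lexMin
  -- the bound f v ≤ 1 holds for non-cut vertices of blocks of either type
  , (λ H block _ v v∈H v-nonCut →
       n≤1⇒n≡0∨n≡1 (nonCut-value≤1 connected blockGraph incomplete f-lexMin block v∈H v-nonCut))
  , λ H block type2 v v∈H v-nonCut →
      nonCut-in-type2-value≡0 connected blockGraph incomplete f-lexMin block v∈H v-nonCut type2
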